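{- Let $\mathfrak{F}$ be a CI frame closed under copying, marginalization, intersection, and lifting. Then for every finite set $N$, every model $\mathcal{M}\in\mathfrak{F}(N)$ is self-adhesive relative to $\mathfrak{F}$ at every set $L\subseteq N$ with $|L|\le 1$.
   Context: For a finite set $N$, $\mathbb{S}(N)$ denotes the set of all CI statements $ij|K$ with $i,j\in N$ distinct and $K\subseteq N\setminus\{i,j\}$, with $ij|K$ and $ji|K$ identified; juxtaposition denotes union. A CI model over $N$ is a subset of $\mathbb{S}(N)$. A CI frame $\mathfrak{F}$ assigns to every finite set $N$ a set $\mathfrak{F}(N)$ of models over $N$ with $\mathbb{S}(N)\in\mathfrak{F}(N)$. A bijection $\varphi:N\to M$ acts by $\varphi(ij|K)=\varphi(i)\varphi(j)|\varphi(K)$; closed under copying: $\mathcal{M}\in\mathfrak{F}(N)\Rightarrow\varphi(\mathcal{M})\in\mathfrak{F}(M)$. Marginal: $\mathcal{M}^{\downarrow M}=\mathcal{M}\cap\mathbb{S}(M)$; closed under marginalization if marginals of members are members. Closed under intersection: $\mathcal{M},\mathcal{A}\in\mathfrak{F}(N)\Rightarrow\mathcal{M}\cap\mathcal{A}\in\mathfrak{F}(N)$. Lift: for $N\subseteq O$, $\mathcal{M}_{N\uparrow O}=\{ij|K\in\mathbb{S}(O):\{i,j\}\cap(O\setminus N)\neq\emptyset\text{ or } ij|(K\cap N)\in\mathcal{M}\}$; closed under lifting if $\mathcal{M}\in\mathfrak{F}(N)$, $N\subseteq O$ imply $\mathcal{M}_{N\uparrow O}\in\mathfrak{F}(O)$.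 For pairwise disjoint $I,J,K$, $I\perp J\,|\,K\,[\mathcal{Z}]$ means $ij|L'\in\mathcal{Z}$ for all $i\in I$, $j\in J$, $K\subseteq L'\subseteq(I\cup J\cup K)\setminus\{i,j\}$. $\mathcal{M}\in\mathfrak{F}(N)$ is self-adhesive at $L\subseteq N$ relative to $\mathfrak{F}$ if for every bijection $\varphi:N\to M$ with $N\cap M=L$ and $\varphi|_L=\mathrm{id}_L$ there is $\mathcal{Z}\in\mathfrak{F}(N\cup M)$ with $\mathcal{Z}^{\downarrow N}=\mathcal{M}$, $\mathcal{Z}^{\downarrow M}=\varphi(\mathcal{M})$, and $(N\setminus M)\perp(M\setminus N)\,|\,L\,[\mathcal{Z}]$. -}

module Defs where

open import Data.Nat using (ℕ; _≤_; _+_)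
open import Data.Nat.Properties using (≤-trans; m≤m+n; m≤n+m)
open import Data.Bool using (Bool; true; false; _∧_; _∨_; not)
open import Data.Product using (Σ; _×_; _,_; ∃)
open import Data.Sum using (_⊎_)
open import Relation.Binary.PropositionalEquality using (_≡_; _≢_; refl)
open import Relation.Nullary using (¬_)

-- All finite ground sets are taken to be finite subsets of
-- ℕ (a countable universe of labels), given by a Boolean characteristic
-- function together with a bound beyond which nothing is a member.

Sub : Set
Sub = ℕ → Bool

_∈ₛ_ : ℕ → Sub → Set
x ∈ₛ K = K x ≡ true

_⊆ₛ_ : Sub → Sub → Set
K ⊆ₛ K' = ∀ x → x ∈ₛ K → x ∈ₛ K'

record FinSet : Set where
  field
    mem   : Sub
    bound : ℕ
    fin   : ∀ n → bound ≤ n → mem n ≡ false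
open FinSet public

_∈_ : ℕ → FinSet → Set
x ∈ N = mem N x ≡ true

_∉_ : ℕ → FinSet → Set
x ∉ N = mem N x ≡ false

_⊆_ : FinSet → FinSet → Set
N ⊆ O = mem N ⊆ₛ mem O

_∪_ : FinSet → FinSet → FinSet
N ∪ M = record
  { mem   = λ x → mem N x ∨ mem M x
  ; bound = bound N + bound M
  ; fin   = λ n b≤n → lemma n b≤n
  }
  where
  lemma : ∀ n → bound N + bound M ≤ n → (mem N n ∨ mem M n) ≡ false
  lemma n p with mem N n in eqN | fin N n (≤-trans (m≤m+n (bound N) (bound M)) p)
  ... | false | _ = fin M n (≤-trans (m≤n+m (bound M) (bound N)) p)
  ... | true  | ()

_∖_ : FinSet → FinSet → Sub
N ∖ M = λ x → mem N x ∧ not (mem M x)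

-- CI statements ij|K over N: i ≠ j, i,j ∈ N, K ⊆ N ∖ {i,j}.

InS : FinSet → ℕ → ℕ → Sub → Set
InS N i j K = (i ≢ j) × (i ∈ N) × (j ∈ N) ×
              (∀ k → k ∈ₛ K → (k ∈ N) × (k ≢ i) × (k ≢ j))

RawModel : Set₁
RawModel = ℕ → ℕ → Sub → Set

-- A raw model is a CI model over N when it is contained in 𝕊(N) and
-- respects the identifications ij|K = ji|K and extensional equality of K.
record IsModel (N : FinSet) (𝓜 : RawModel) : Set where
  field
    sym   : ∀ {i j K} → 𝓜 i j K → 𝓜 j i K
    ext   : ∀ {i j K K'} → (∀ k → K k ≡ K' k) → 𝓜 i j K → 𝓜 i j K'
    sound : ∀ {i j K} → 𝓜 i j K → InS N i j K

𝕊 : FinSet → RawModel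
𝕊 N = InS N

_≐_ : RawModel → RawModel → Set
𝓜 ≐ 𝓐 = ∀ i j K → (𝓜 i j K → 𝓐 i j K) × (𝓐 i j K → 𝓜 i j K)

_∩ₘ_ : RawModel → RawModel → RawModel
(𝓜 ∩ₘ 𝓐) i j K = 𝓜 i j K × 𝓐 i j K

marg : RawModel → FinSet → RawModel
marg 𝓜 M i j K = 𝓜 i j K × InS M i j K

lift : FinSet → FinSet → RawModel → RawModel
lift N O 𝓜 i j K =
  InS O i j K × (i ∉ N ⊎ j ∉ N ⊎ 𝓜 i j (λ x → K x ∧ mem N x))

record Bij (N M : FinSet) : Set where
  field
    φ      : ℕ → ℕ
    ψ      : ℕ → ℕ
    φ-into : ∀ x → x ∈ N → φ x ∈ M
    ψ-into : ∀ y → y ∈ M → ψ y ∈ N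
    ψφ     : ∀ x → x ∈ N → ψ (φ x) ≡ x
    φψ     : ∀ y → y ∈ M → φ (ψ y) ≡ y
open Bij public

copy : ∀ {N M} → Bij N M → RawModel → RawModel
copy b 𝓜 i' j' K' =
  Σ ℕ λ i → Σ ℕ λ j → Σ Sub λ K →
    𝓜 i j K × i' ≡ φ b i × j' ≡ φ b j ×
    (∀ y → (y ∈ₛ K' → ∃ λ x → x ∈ₛ K × φ b x ≡ y) ×
           ((∃ λ x → x ∈ₛ K × φ b x ≡ y) → y ∈ₛ K'))

record CIFrame : Set₁ where
  field
    𝔉     : FinSet → RawModel → Set
    model : ∀ {N 𝓜} → 𝔉 N 𝓜 → IsModel N 𝓜
    full  : ∀ N → 𝔉 N (𝕊 N)
open CIFrame public

ClosedUnderCopying : CIFrame → Set₁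
ClosedUnderCopying 𝔽 =
  ∀ N M (b : Bij N M) 𝓜 → 𝔉 𝔽 N 𝓜 → 𝔉 𝔽 M (copy b 𝓜)

ClosedUnderMarginalization : CIFrame → Set₁
ClosedUnderMarginalization 𝔽 =
  ∀ N M 𝓜 → M ⊆ N → 𝔉 𝔽 N 𝓜 → 𝔉 𝔽 M (marg 𝓜 M)

ClosedUnderIntersection : CIFrame → Set₁
ClosedUnderIntersection 𝔽 =
  ∀ N 𝓜 𝓐 → 𝔉 𝔽 N 𝓜 → 𝔉 𝔽 N 𝓐 → 𝔉 𝔽 N (𝓜 ∩ₘ 𝓐)

ClosedUnderLifting : CIFrame → Set₁
ClosedUnderLifting 𝔽 =
  ∀ N O 𝓜 → N ⊆ O → 𝔉 𝔽 N 𝓜 → 𝔉 𝔽 O (lift N O 𝓜)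

Indep : Sub → Sub → Sub → RawModel → Set
Indep I J K 𝓩 =
  ∀ i j L' → i ∈ₛ I → j ∈ₛ J → K ⊆ₛ L' →
  (∀ x → x ∈ₛ L' → (x ∈ₛ I ⊎ x ∈ₛ J ⊎ x ∈ₛ K) × x ≢ i × x ≢ j) →
  𝓩 i j L'

SelfAdhesive : CIFrame → FinSet → RawModel → FinSet → Set₁
SelfAdhesive 𝔽 N 𝓜 L =
  ∀ (M : FinSet) (b : Bij N M) →
  (∀ x → ((x ∈ N × x ∈ M) → x ∈ L) × (x ∈ L → x ∈ N × x ∈ M)) →
  (∀ x → x ∈ L → φ b x ≡ x) →
  Σ RawModel λ 𝓩 →
    𝔉 𝔽 (N ∪ M) 𝓩 ×
    (marg 𝓩 N ≐ 𝓜) ×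
    (marg 𝓩 M ≐ copy b 𝓜) ×
    Indep (N ∖ M) (M ∖ N) (mem L) 𝓩

AtMostOne : FinSet → Set
AtMostOne L = ∀ x y → x ∈ L → y ∈ L → x ≡ y

{-# OPTIONS --safe #-}
-- Glue 𝓜 and its copy φ(𝓜) by lifting both to N ∪ M and intersecting the lifts.
-- Since N and M share at most one element, no statement ij|K over N has both
-- i and j in M, so the lift of φ(𝓜) contains all of 𝕊(N) and does not cut down
-- the marginal on N (symmetrically on M).  A statement ij|K with i ∈ N ∖ M and
-- j ∈ M ∖ N has an endpoint outside each ground set, so it lies in both lifts.
module Submission where

open import Defs
open import Data.Bool using (true; false; _∧_; _∨_)
open import Data.Bool.Properties using (∧-conicalˡ; ∧-conicalʳ; ∨-zeroʳ; not-injective; not-¬)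
open import Data.Product using (_×_; _,_; proj₁)
open import Data.Sum using (_⊎_; inj₁; inj₂)
open import Relation.Binary.PropositionalEquality using (_≡_; _≢_; refl; sym; trans; cong)
open import Relation.Nullary using (¬_; contradiction)

⊆-∪ˡ : ∀ A B → A ⊆ (A ∪ B)
⊆-∪ˡ A B x x∈A = cong (_∨ mem B x) x∈A

⊆-∪ʳ : ∀ A B → B ⊆ (A ∪ B)
⊆-∪ʳ A B x x∈B = trans (cong (mem A x ∨_) x∈B) (∨-zeroʳ (mem A x))

∈∖⇒∈×∉ : ∀ {x} A B → x ∈ₛ (A ∖ B) → x ∈ A × x ∉ B
∈∖⇒∈×∉ {x} A B x∈A∖B =
  ∧-conicalˡ (mem A x) _ x∈A∖B , not-injective (∧-conicalʳ (mem A x) _ x∈A∖B)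

InS-mono : ∀ A O {i j K} → A ⊆ O → InS A i j K → InS O i j K
InS-mono A O A⊆O (i≢j , i∈A , j∈A , K⊆A) =
  i≢j , A⊆O _ i∈A , A⊆O _ j∈A ,
  λ k k∈K → let (k∈A , k≢i , k≢j) = K⊆A k k∈K in A⊆O k k∈A , k≢i , k≢j

InS⇒K∧A≗K : ∀ A {i j K} → InS A i j K → ∀ x → (K x ∧ mem A x) ≡ K x
InS⇒K∧A≗K A {K = K} (_ , _ , _ , K⊆A) x with K x in x∈?K
... | false = refl
... | true  = proj₁ (K⊆A x x∈?K)

∈⊎∉ : ∀ x A → x ∈ A ⊎ x ∉ A
∈⊎∉ x A with mem A x
... | true  = inj₁ refl
... | false = inj₂ refl

lift-outside : ∀ A O 𝓐 {i j K} → InS O i j K → ¬ (i ∈ A × j ∈ A) → lift A O 𝓐 i j K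
lift-outside A O 𝓐 {i} {j} ins ¬both with ∈⊎∉ i A | ∈⊎∉ j A
... | inj₂ i∉A | _        = ins , inj₁ i∉A
... | inj₁ _   | inj₂ j∉A = ins , inj₂ (inj₁ j∉A)
... | inj₁ i∈A | inj₁ j∈A = contradiction (i∈A , j∈A) ¬both

≐-trans : ∀ {𝓧 𝓨 𝓩} → 𝓧 ≐ 𝓨 → 𝓨 ≐ 𝓩 → 𝓧 ≐ 𝓩
≐-trans 𝓧≐𝓨 𝓨≐𝓩 i j K =
  let (to , from) = 𝓧≐𝓨 i j K ; (to′ , from′) = 𝓨≐𝓩 i j K
  in (λ x → to′ (to x)) , (λ z → from (from′ z))

marg-lift : ∀ A O {𝓐} → A ⊆ O → IsModel A 𝓐 → marg (lift A O 𝓐) A ≐ 𝓐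
marg-lift A O {𝓐} A⊆O 𝓐-model i j K = restrict , extend
  where
  restrict : marg (lift A O 𝓐) A i j K → 𝓐 i j K
  restrict ((_ , inj₁ i∉A) , (_ , i∈A , _)) = contradiction i∉A (not-¬ i∈A)
  restrict ((_ , inj₂ (inj₁ j∉A)) , (_ , _ , j∈A , _)) = contradiction j∉A (not-¬ j∈A)
  restrict ((_ , inj₂ (inj₂ ijK∩A)) , ins) = IsModel.ext 𝓐-model (InS⇒K∧A≗K A ins) ijK∩A

  extend : 𝓐 i j K → marg (lift A O 𝓐) A i j K
  extend ijK = (InS-mono A O A⊆O ins , inj₂ (inj₂ ijK∩A)) , ins
    where
    ins : InS A i j K
    ins = IsModel.sound 𝓐-model ijK
    ijK∩A : 𝓐 i j (λ x → K x ∧ mem A x)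
    ijK∩A = IsModel.ext 𝓐-model (λ x → sym (InS⇒K∧A≗K A ins x)) ijK

marg-∩-redundantʳ : ∀ A {𝓧 𝓨} → (∀ {i j K} → InS A i j K → 𝓨 i j K) →
  marg (𝓧 ∩ₘ 𝓨) A ≐ marg 𝓧 A
marg-∩-redundantʳ A 𝕊A⊆𝓨 i j K =
  (λ ((ijK , _) , ins) → ijK , ins) , (λ (ijK , ins) → (ijK , 𝕊A⊆𝓨 ins) , ins)

marg-∩-redundantˡ : ∀ A {𝓧 𝓨} → (∀ {i j K} → InS A i j K → 𝓨 i j K) →
  marg (𝓨 ∩ₘ 𝓧) A ≐ marg 𝓧 A
marg-∩-redundantˡ A 𝕊A⊆𝓨 i j K =
  (λ ((_ , ijK) , ins) → ijK , ins) , (λ (ijK , ins) → (𝕊A⊆𝓨 ins , ijK) , ins)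

SharesAtMostOne : FinSet → FinSet → Set
SharesAtMostOne A B = ∀ x y → x ∈ A → x ∈ B → y ∈ A → y ∈ B → x ≡ y

SharesAtMostOne-sym : ∀ A B → SharesAtMostOne A B → SharesAtMostOne B A
SharesAtMostOne-sym A B shared x y x∈B x∈A y∈B y∈A = shared x y x∈A x∈B y∈A y∈B

𝕊⊆lift : ∀ A B O 𝓑 {i j K} → A ⊆ O → SharesAtMostOne A B →
  InS A i j K → lift B O 𝓑 i j K
𝕊⊆lift A B O 𝓑 {i} {j} A⊆O shared ins@(i≢j , i∈A , j∈A , _) =
  lift-outside B O 𝓑 (InS-mono A O A⊆O ins)
    λ (i∈B , j∈B) → i≢j (shared i j i∈A i∈B j∈A j∈B)

glue : FinSet → FinSet → RawModel → RawModel → RawModel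
glue A B 𝓐 𝓑 = lift A (A ∪ B) 𝓐 ∩ₘ lift B (A ∪ B) 𝓑

glue-∈𝔉 : ∀ 𝔽 → ClosedUnderIntersection 𝔽 → ClosedUnderLifting 𝔽 →
  ∀ {A B 𝓐 𝓑} → 𝔉 𝔽 A 𝓐 → 𝔉 𝔽 B 𝓑 → 𝔉 𝔽 (A ∪ B) (glue A B 𝓐 𝓑)
glue-∈𝔉 𝔽 ∩-closed lift-closed {A} {B} {𝓐} {𝓑} 𝓐∈𝔉 𝓑∈𝔉 =
  ∩-closed (A ∪ B) _ _ (lift-closed A (A ∪ B) 𝓐 (⊆-∪ˡ A B) 𝓐∈𝔉)
                       (lift-closed B (A ∪ B) 𝓑 (⊆-∪ʳ A B) 𝓑∈𝔉)

marg-glueˡ : ∀ A B 𝓐 𝓑 → SharesAtMostOne A B → IsModel A 𝓐 →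
  marg (glue A B 𝓐 𝓑) A ≐ 𝓐
marg-glueˡ A B 𝓐 𝓑 shared 𝓐-model =
  ≐-trans (marg-∩-redundantʳ A (𝕊⊆lift A B (A ∪ B) 𝓑 (⊆-∪ˡ A B) shared))
          (marg-lift A (A ∪ B) (⊆-∪ˡ A B) 𝓐-model)

marg-glueʳ : ∀ A B 𝓐 𝓑 → SharesAtMostOne A B → IsModel B 𝓑 →
  marg (glue A B 𝓐 𝓑) B ≐ 𝓑
marg-glueʳ A B 𝓐 𝓑 shared 𝓑-model =
  ≐-trans (marg-∩-redundantˡ B
             (𝕊⊆lift B A (A ∪ B) 𝓐 (⊆-∪ʳ A B) (SharesAtMostOne-sym A B shared)))
          (marg-lift B (A ∪ B) (⊆-∪ʳ A B) 𝓑-model)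

glue-Indep : ∀ A B 𝓐 𝓑 {L} → L ⊆ₛ mem (A ∪ B) →
  Indep (A ∖ B) (B ∖ A) L (glue A B 𝓐 𝓑)
glue-Indep A B 𝓐 𝓑 {L} L⊆A∪B i j L′ i∈A∖B j∈B∖A _ L′-range
  with ∈∖⇒∈×∉ A B i∈A∖B | ∈∖⇒∈×∉ B A j∈B∖A
... | i∈A , i∉B | j∈B , j∉A =
  lift-outside A (A ∪ B) 𝓐 ins (λ (_ , j∈A) → not-¬ j∈A j∉A) ,
  lift-outside B (A ∪ B) 𝓑 ins (λ (i∈B , _) → not-¬ i∈B i∉B)
  where
  i≢j : i ≢ j
  i≢j refl = not-¬ j∈B i∉B

  range⊆A∪B : ∀ x → x ∈ₛ (A ∖ B) ⊎ x ∈ₛ (B ∖ A) ⊎ x ∈ₛ L → x ∈ (A ∪ B)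
  range⊆A∪B x (inj₁ x∈A∖B)        = ⊆-∪ˡ A B x (proj₁ (∈∖⇒∈×∉ A B x∈A∖B))
  range⊆A∪B x (inj₂ (inj₁ x∈B∖A)) = ⊆-∪ʳ A B x (proj₁ (∈∖⇒∈×∉ B A x∈B∖A))
  range⊆A∪B x (inj₂ (inj₂ x∈L))   = L⊆A∪B x x∈L

  ins : InS (A ∪ B) i j L′
  ins = i≢j , ⊆-∪ˡ A B i i∈A , ⊆-∪ʳ A B j j∈B ,
        λ x x∈L′ → let (x-in-range , x≢i , x≢j) = L′-range x x∈L′
                   in range⊆A∪B x x-in-range , x≢i , x≢j

corollary4p12 : (𝔽 : CIFrame) →
    ClosedUnderCopying 𝔽 → ClosedUnderMarginalization 𝔽 →
    ClosedUnderIntersection 𝔽 → ClosedUnderLifting 𝔽 →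
    ∀ (N : FinSet) (𝓜 : RawModel) → 𝔉 𝔽 N 𝓜 →
    ∀ (L : FinSet) → L ⊆ N → AtMostOne L →
    SelfAdhesive 𝔽 N 𝓜 L
corollary4p12 𝔽 copy-closed _ ∩-closed lift-closed N 𝓜 𝓜∈𝔉 L L⊆N |L|≤1 M b N∩M≡L _ =
  glue N M 𝓜 (copy b 𝓜) ,
  glue-∈𝔉 𝔽 ∩-closed lift-closed 𝓜∈𝔉 φ𝓜∈𝔉 ,
  marg-glueˡ N M 𝓜 (copy b 𝓜) shared (model 𝔽 𝓜∈𝔉) ,
  marg-glueʳ N M 𝓜 (copy b 𝓜) shared (model 𝔽 φ𝓜∈𝔉) ,
  glue-Indep N M 𝓜 (copy b 𝓜) (λ x x∈L → ⊆-∪ˡ N M x (L⊆N x x∈L))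
  where
  φ𝓜∈𝔉 : 𝔉 𝔽 M (copy b 𝓜)
  φ𝓜∈𝔉 = copy-closed N M b 𝓜 𝓜∈𝔉

  shared : SharesAtMostOne N M
  shared x y x∈N x∈M y∈N y∈M =
    |L|≤1 x y (proj₁ (N∩M≡L x) (x∈N , x∈M)) (proj₁ (N∩M≡L y) (y∈N , y∈M))
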